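{- Let $G$ be a minimal counterexample (as defined in the context). Let $v\in V(G)$ with $3\leq d(v)\leq 4$ $(=\lfloor\frac{\Delta+1}{2}\rfloor)$. Then $v$ is not a $(2,1^+,1^+,\dots,1^+)$-vertex; that is, it is not the case that one of the paths incident to $v$ is a $2$-path and all the other $d(v)-1$ paths incident to $v$ are $j$-paths with $j\geq 1$.
   Context: A $2$-distance $k$-coloring of a graph assigns colors from $\{1,\dots,k\}$ so that distinct vertices at distance at most $2$ get different colors. A minimal counterexample is a finite simple graph $G$ with $\mathrm{mad}(G)\leq 18/7$ (equivalently $9|A|-7|E(G[A])|\geq 0$ for all $A\subseteq V(G)$), maximum degree $\Delta(G)=7$, that has no $2$-distance $8$-coloring, and such that every graph $H$ with $\mathrm{mad}(H)\leq 18/7$, maximum degree at most $7$ and $|V(H)|+|E(H)|<|V(G)|+|E(G)|$ has a $2$-distance $8$-coloring. A $k$-path is a path of length $k+1$ whose $k$ internal vertices have degree $2$ in $G$. For a vertex $v$ of degree $d\geq 3$, each edge $vw$ starts a path incident to $v$: the maximal walk $v=x_0,x_1=w,x_2,\dots,x_{k+1}$ in which $x_1,\dots,x_k$ have degree $2$ and $x_{k+1}$ does not; it is a $k$-path ($k=0$ if $d(w)\neq 2$). $v$ is a $(k_1,\dots,k_d)$-vertex if its $d$ incident paths are a $k_1$-path, ..., a $k_d$-path; $k^+$ means "some $j\geq k$". -}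

module Defs where

open import Data.Nat using (ℕ; zero; suc; _+_; _*_; _≤_; _<_)
open import Data.Fin using (Fin; toℕ)
open import Data.Bool using (Bool; true; false; _∧_)
open import Data.List using (List; length; filter; allFin; concatMap; map)
open import Data.Product using (Σ; ∃; _×_; _,_)
open import Data.Sum using (_⊎_)
open import Relation.Nullary using (¬_)
open import Relation.Binary.PropositionalEquality using (_≡_; _≢_)
open import Relation.Nullary.Decidable using (⌊_⌋)
open import Data.Nat using (_<?_)

record Graph : Set where
  field
    n      : ℕ
    adj    : Fin n → Fin n → Bool
    sym    : ∀ u v → adj u v ≡ adj v u
    irrefl : ∀ v → adj v v ≡ false
open Graph public

count : {n : ℕ} → (Fin n → Bool) → ℕ
count {n} P = length (filter (λ x → P x ≡? true) (allFin n))
  where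
  open import Data.Bool.Properties using () renaming (_≟_ to _≡?_)

deg : (G : Graph) → Fin (n G) → ℕ
deg G v = count (adj G v)

edgesIn : (G : Graph) → (Fin (n G) → Bool) → ℕ
edgesIn G A = length (filter (λ p → isEdge p ≡? true) pairs)
  where
  open import Data.Bool.Properties using () renaming (_≟_ to _≡?_)
  pairs : List (Fin (n G) × Fin (n G))
  pairs = concatMap (λ u → map (λ w → u , w) (allFin (n G))) (allFin (n G))
  isEdge : Fin (n G) × Fin (n G) → Bool
  isEdge (u , w) = A u ∧ A w ∧ adj G u w ∧ ⌊ toℕ u <? toℕ w ⌋

numEdges : Graph → ℕ
numEdges G = edgesIn G (λ _ → true)

-- mad(G) ≤ 18/7, in the form 9|A| - 7|E(G[A])| ≥ 0 for all A ⊆ V(G)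
MadLe18/7 : Graph → Set
MadLe18/7 G = (A : Fin (n G) → Bool) → 7 * edgesIn G A ≤ 9 * count A

MaxDegLe : Graph → ℕ → Set
MaxDegLe G d = ∀ v → deg G v ≤ d

MaxDegEq : Graph → ℕ → Set
MaxDegEq G d = MaxDegLe G d × ∃ λ v → deg G v ≡ d

Dist≤2 : (G : Graph) → Fin (n G) → Fin (n G) → Set
Dist≤2 G u v = adj G u v ≡ true ⊎ ∃ λ w → adj G u w ≡ true × adj G w v ≡ true

TwoDistColoring : (G : Graph) → (k : ℕ) → (Fin (n G) → Fin k) → Set
TwoDistColoring G k c = ∀ u v → u ≢ v → Dist≤2 G u v → c u ≢ c v

TwoDistColorable : Graph → ℕ → Set
TwoDistColorable G k = ∃ λ (c : Fin (n G) → Fin k) → TwoDistColoring G k c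

size : Graph → ℕ
size G = n G + numEdges G

record MinimalCounterexample (G : Graph) : Set where
  field
    mad     : MadLe18/7 G
    maxDeg  : MaxDegEq G 7
    noCol   : ¬ TwoDistColorable G 8
    minimal : (H : Graph) → MadLe18/7 H → MaxDegLe H 7 → size H < size G →
              TwoDistColorable H 8

-- Thread G p c k : the maximal walk p , c , x₂ , … that continues through
-- vertices of degree 2 (never stepping back) stops after exactly k vertices
-- of degree 2 (c being the first one), i.e. ends at a vertex of degree ≠ 2.
data Thread (G : Graph) : Fin (n G) → Fin (n G) → ℕ → Set where
  stop : ∀ {p c} → deg G c ≢ 2 → Thread G p c 0
  step : ∀ {p c c' k} → deg G c ≡ 2 → adj G c c' ≡ true → c' ≢ p →
         Thread G c c' k → Thread G p c (suc k)

IncidentKPath : (G : Graph) → Fin (n G) → Fin (n G) → ℕ → Set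
IncidentKPath G v w k = adj G v w ≡ true × Thread G v w k

Is2-1⁺Vertex : (G : Graph) → Fin (n G) → Set
Is2-1⁺Vertex G v =
  ∃ λ w → IncidentKPath G v w 2 ×
    (∀ w' → adj G v w' ≡ true → w' ≢ w → ∃ λ k → 1 ≤ k × IncidentKPath G v w' k)

-- Let v a b x be the 2-path at v, and let every other neighbour u of v be of degree 2
-- with second neighbour o(u). Deleting the edges at a and b keeps mad ≤ 18/7 and Δ ≤ 7
-- and shrinks G, so by minimality the rest of G has a 2-distance 8-colouring. It
-- extends greedily: b sees only x and the other ≤ 6 neighbours of x; v (recoloured)
-- sees b, its ≤ 3 other neighbours and their second neighbours, 7 vertices in all; and
-- finally a sees v, b, x and the ≤ 3 other neighbours of v. Only d(v) ≤ 4 is used.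
module Submission where

open import Defs hiding (sym)
open import Level using (0ℓ)
open import Data.Nat using (suc; _≤_; _<_; _<?_; s≤s)
open import Data.Nat.Properties
  using (≤-trans; ≤∧≢⇒<; ≤-pred; *-monoʳ-≤; +-monoʳ-<; +-mono-≤; m≤n⇒m≤1+n)
open import Data.Fin using (Fin; toℕ; _≟_)
open import Data.Fin.Properties using (pigeonhole; ¬∀⟶∃¬; <⇒≢; <-cmp)
open import Data.Bool using (Bool; true; false; _∧_; not; if_then_else_)
open import Data.Bool.Properties using (∧-comm; ∧-zeroʳ) renaming (_≟_ to _≟ᵇ_)
open import Data.List using (List; []; _∷_; length; filter; allFin; map; concatMap; _++_; lookup)
open import Data.List.Properties using (filter-notAll; length-map; length-++)
open import Data.List.Membership.Propositional using (_∈_; _∉_)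
open import Data.List.Membership.Propositional.Properties
  using (∈-filter⁺; ∈-filter⁻; ∈-allFin; ∈-map⁺; ∈-++⁺ˡ; ∈-++⁺ʳ; ∈-concat⁺′)
import Data.List.Membership.DecPropositional
open import Data.List.Relation.Unary.Any using (here; there; index)
import Data.List.Relation.Unary.Any as Any
open import Data.List.Relation.Unary.Any.Properties using (lookup-index)
open import Data.List.Relation.Binary.Sublist.Propositional using (_⊆_; ⊆-refl)
open import Data.List.Relation.Binary.Sublist.Propositional.Properties
  using (filter⁺; length-mono-≤; to-≋)
open import Data.List.Relation.Binary.Equality.Propositional using (≋⇒≡)
open import Data.Product using (∃; _×_; _,_; proj₁; proj₂)
open import Data.Sum using (_⊎_; inj₁; inj₂)
open import Function using (_∘_; case_of_)
open import Relation.Nullary using (¬_; Dec; yes; no; ¬?; does; contradiction)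
open import Relation.Nullary.Decidable using (⌊_⌋; isYes≗does; dec-true; dec-false; _⊎-dec_; _×-dec_)
open import Relation.Unary using (Pred; Decidable)
open import Relation.Binary.Definitions using (tri<; tri≈; tri>)
open import Relation.Binary.PropositionalEquality
  using (_≡_; _≢_; refl; sym; trans; cong; cong₂; subst; subst₂)

module _ {A : Set} {P Q : Pred A 0ℓ} (P? : Decidable P) (Q? : Decidable Q)
         (P⇒Q : ∀ {y} → P y → Q y) where

  filter-⊆ : ∀ xs → filter P? xs ⊆ filter Q? xs
  filter-⊆ xs = filter⁺ P? Q? {xs} {xs} (λ { refl → P⇒Q }) ⊆-refl

  length-filter-mono : ∀ xs → length (filter P? xs) ≤ length (filter Q? xs)
  length-filter-mono xs = length-mono-≤ (filter-⊆ xs)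

  -- A sublist of the same length is the whole list, so it would contain y.
  length-filter-mono-< : ∀ {xs y} → y ∈ xs → Q y → ¬ P y →
                         length (filter P? xs) < length (filter Q? xs)
  length-filter-mono-< {xs} {y} y∈xs Qy ¬Py = ≤∧≢⇒< (length-filter-mono xs) λ same-length →
    let filters≡ = ≋⇒≡ (to-≋ same-length (filter-⊆ xs))
        y∈filterQ = ∈-filter⁺ Q? {xs = xs} y∈xs Qy
    in ¬Py (proj₂ (∈-filter⁻ P? {xs = xs} (subst (y ∈_) (sym filters≡) y∈filterQ)))

∃-∉ : ∀ {k} (cs : List (Fin k)) → length cs < k → ∃ λ c → c ∉ cs
∃-∉ {k} cs |cs|<k = ¬∀⟶∃¬ k (_∈ cs) (_∈? cs) all-in
  where
  open Data.List.Membership.DecPropositional (_≟_ {k}) using (_∈?_)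
  all-in : ¬ (∀ c → c ∈ cs)
  all-in c∈cs with i , j , i<j , same-index ← pigeonhole |cs|<k (index ∘ c∈cs) =
    <⇒≢ i<j (trans (lookup-index (c∈cs i))
                   (trans (cong (lookup cs) same-index) (sym (lookup-index (c∈cs j)))))

length≡2⇒∈⇒≡⊎≡ : ∀ {A : Set} {xs : List A} {p q w : A} → length xs ≡ 2 →
                  p ∈ xs → q ∈ xs → p ≢ q → w ∈ xs → w ≡ p ⊎ w ≡ q
length≡2⇒∈⇒≡⊎≡ {xs = _ ∷ _ ∷ []} _ (here refl) (here refl) p≢q _ = contradiction refl p≢q
length≡2⇒∈⇒≡⊎≡ {xs = _ ∷ _ ∷ []} _ (there (here refl)) (there (here refl)) p≢q _ = contradiction refl p≢q
length≡2⇒∈⇒≡⊎≡ {xs = _ ∷ _ ∷ []} _ (here refl) (there (here refl)) _ (here refl) = inj₁ refl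
length≡2⇒∈⇒≡⊎≡ {xs = _ ∷ _ ∷ []} _ (here refl) (there (here refl)) _ (there (here refl)) = inj₂ refl
length≡2⇒∈⇒≡⊎≡ {xs = _ ∷ _ ∷ []} _ (there (here refl)) (here refl) _ (here refl) = inj₂ refl
length≡2⇒∈⇒≡⊎≡ {xs = _ ∷ _ ∷ []} _ (there (here refl)) (here refl) _ (there (here refl)) = inj₁ refl

∧-true⇒ˡ : ∀ {x y} → x ∧ y ≡ true → x ≡ true
∧-true⇒ˡ {true} _ = refl

∧-monoˡ-true : ∀ {x x′ y} → (x ≡ true → x′ ≡ true) → x ∧ y ≡ true → x′ ∧ y ≡ true
∧-monoˡ-true {true} f xy rewrite f refl = xy

∧-monoʳ-true : ∀ {x y y′} → (y ≡ true → y′ ≡ true) → x ∧ y ≡ true → x ∧ y′ ≡ true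
∧-monoʳ-true {true} f xy = f xy

choice-on-decidable : ∀ {A : Set} {P : Pred A 0ℓ} {R : A → A → Set} → Decidable P →
                      (∀ {u} → P u → ∃ (R u)) → ∃ λ f → ∀ {u} → P u → R u (f u)
choice-on-decidable {A} {P} {R} P? r = f , f-spec
  where
  f : A → A
  f u with P? u
  ... | yes Pu = proj₁ (r Pu)
  ... | no _ = u
  f-spec : ∀ {u} → P u → R u (f u)
  f-spec {u} Pu with P? u
  ... | yes Pu′ = proj₂ (r Pu′)
  ... | no ¬Pu = contradiction Pu ¬Pu

Vertex : Graph → Set
Vertex G = Fin (n G)

module _ (G : Graph) where

  adj-sym : ∀ {u w} → adj G u w ≡ true → adj G w u ≡ true
  adj-sym {u} {w} e = trans (Graph.sym G w u) e

  adj⇒≢ : ∀ {u w} → adj G u w ≡ true → u ≢ w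
  adj⇒≢ {u} e refl = case trans (sym e) (irrefl G u) of λ ()

  Dist≤2-sym : ∀ {u w} → Dist≤2 G u w → Dist≤2 G w u
  Dist≤2-sym (inj₁ e) = inj₁ (adj-sym e)
  Dist≤2-sym (inj₂ (m , e₁ , e₂)) = inj₂ (m , adj-sym e₂ , adj-sym e₁)

  neighbours : Vertex G → List (Vertex G)
  neighbours u = filter (λ w → adj G u w ≟ᵇ true) (allFin (n G))

  ∈-neighbours : ∀ {u w} → adj G u w ≡ true → w ∈ neighbours u
  ∈-neighbours {u} {w} e = ∈-filter⁺ (λ y → adj G u y ≟ᵇ true) (∈-allFin w) e

  deg≡2⇒adj⇒≡⊎≡ : ∀ {u p q w} → deg G u ≡ 2 → adj G u p ≡ true → adj G u q ≡ true →
                   p ≢ q → adj G u w ≡ true → w ≡ p ⊎ w ≡ q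
  deg≡2⇒adj⇒≡⊎≡ d up uq p≢q uw =
    length≡2⇒∈⇒≡⊎≡ d (∈-neighbours up) (∈-neighbours uq) p≢q (∈-neighbours uw)

  neighboursExcept : Vertex G → Vertex G → List (Vertex G)
  neighboursExcept u w = filter (λ y → ¬? (y ≟ w)) (neighbours u)

  ∈-neighboursExcept : ∀ {u w y} → adj G u y ≡ true → y ≢ w → y ∈ neighboursExcept u w
  ∈-neighboursExcept {w = w} e y≢w = ∈-filter⁺ (λ y → ¬? (y ≟ w)) (∈-neighbours e) y≢w

  length-neighboursExcept< : ∀ {u w} → adj G u w ≡ true → length (neighboursExcept u w) < deg G u
  length-neighboursExcept< {u} {w} e =
    filter-notAll (λ y → ¬? (y ≟ w)) (neighbours u)
                  (Any.map (λ { refl y≢y → y≢y refl }) (∈-neighbours e))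

  ProperOn : ∀ {k} → (Vertex G → Fin k) → Pred (Vertex G) 0ℓ → Set
  ProperOn c P = ∀ {u w} → P u → P w → u ≢ w → Dist≤2 G u w → c u ≢ c w

  ProperOn-extend : ∀ {k} {P : Pred (Vertex G) 0ℓ} (c : Vertex G → Fin k) → ProperOn c P →
                    (z : Vertex G) (D : List (Vertex G)) → length D < k →
                    (∀ {w} → P w → w ≢ z → Dist≤2 G z w → w ∈ D) →
                    ∃ λ c′ → ProperOn c′ (λ u → u ≡ z ⊎ P u)
  ProperOn-extend {k} {P} c proper z D |D|<k D-covers = c′ , proper′
    where
    free : ∃ λ colour → colour ∉ map c D
    free = ∃-∉ (map c D) (subst (_< k) (sym (length-map c D)) |D|<k)

    c′ : Vertex G → Fin k
    c′ u = if does (u ≟ z) then proj₁ free else c u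

    c′-at : c′ z ≡ proj₁ free
    c′-at rewrite dec-true (z ≟ z) refl = refl

    c′-off : ∀ {u} → u ≢ z → c′ u ≡ c u
    c′-off {u} u≢z rewrite dec-false (u ≟ z) u≢z = refl

    free-apart : ∀ {u w} → u ≡ z → P w → w ≢ z → Dist≤2 G u w → c′ u ≢ c′ w
    free-apart refl Pw w≢z d = subst₂ _≢_ (sym c′-at) (sym (c′-off w≢z)) λ free≡cw →
      proj₂ free (subst (_∈ map c D) (sym free≡cw) (∈-map⁺ c (D-covers Pw w≢z d)))

    old : ∀ {u} → u ≡ z ⊎ P u → u ≢ z → P u
    old (inj₁ u≡z) u≢z = contradiction u≡z u≢z
    old (inj₂ Pu) _ = Pu

    proper′ : ProperOn c′ (λ u → u ≡ z ⊎ P u)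
    proper′ {u} {w} Pu Pw u≢w d = by-cases (u ≟ z) (w ≟ z)
      where
      by-cases : Dec (u ≡ z) → Dec (w ≡ z) → c′ u ≢ c′ w
      by-cases (yes u≡z) (yes w≡z) = contradiction (trans u≡z (sym w≡z)) u≢w
      by-cases (yes u≡z) (no w≢z) = free-apart u≡z (old Pw w≢z) w≢z d
      by-cases (no u≢z) (yes w≡z) = free-apart w≡z (old Pu u≢z) u≢z (Dist≤2-sym d) ∘ sym
      by-cases (no u≢z) (no w≢z) =
        subst₂ _≢_ (sym (c′-off u≢z)) (sym (c′-off w≢z)) (proper (old Pu u≢z) (old Pw w≢z) u≢w d)

  1⁺-paths⇒second-neighbours :
    ∀ {v a} → (∀ w → adj G v w ≡ true → w ≢ a → ∃ λ k → 1 ≤ k × IncidentKPath G v w k) →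
    ∃ λ other → ∀ {u} → adj G v u ≡ true × u ≢ a →
                deg G u ≡ 2 × adj G u (other u) ≡ true × other u ≢ v
  1⁺-paths⇒second-neighbours {v} {a} paths-1⁺ =
    choice-on-decidable (λ u → (adj G v u ≟ᵇ true) ×-dec ¬? (u ≟ a)) second-neighbour
    where
    second-neighbour : ∀ {u} → adj G v u ≡ true × u ≢ a →
                       ∃ λ o → deg G u ≡ 2 × adj G u o ≡ true × o ≢ v
    second-neighbour (vu , u≢a) with paths-1⁺ _ vu u≢a
    ... | suc _ , _ , _ , step u-deg uo o≢v _ = _ , u-deg , uo , o≢v

-- These unfold to the local definitions inside edgesIn, so edgesIn G A is literally the
-- number of pairs in vertexPairs G accepted by isEdgeOf G A.
isEdgeOf : (G : Graph) → (Vertex G → Bool) → Vertex G × Vertex G → Bool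
isEdgeOf G A (u , w) = A u ∧ A w ∧ adj G u w ∧ ⌊ toℕ u <? toℕ w ⌋

vertexPairs : (G : Graph) → List (Vertex G × Vertex G)
vertexPairs G = concatMap (λ u → map (u ,_) (allFin (n G))) (allFin (n G))

∈-vertexPairs : ∀ G (u w : Vertex G) → (u , w) ∈ vertexPairs G
∈-vertexPairs G u w = ∈-concat⁺′ (∈-map⁺ (u ,_) (∈-allFin w)) (∈-map⁺ _ (∈-allFin u))

module _ (G : Graph) {S : Pred (Vertex G) 0ℓ} (S? : Decidable S) where

  kept : Vertex G → Bool
  kept u = not (does (S? u))

  isolate : Graph
  isolate = record
    { n = n G
    ; adj = λ u w → adj G u w ∧ kept u ∧ kept w
    ; sym = λ u w → cong₂ _∧_ (Graph.sym G u w) (∧-comm (kept u) (kept w))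
    ; irrefl = λ u → cong (_∧ (kept u ∧ kept u)) (irrefl G u)
    }

  adj-isolate⇒adj : ∀ {u w} → adj isolate u w ≡ true → adj G u w ≡ true
  adj-isolate⇒adj = ∧-true⇒ˡ

  adj⇒adj-isolate : ∀ {u w} → ¬ S u → ¬ S w → adj G u w ≡ true → adj isolate u w ≡ true
  adj⇒adj-isolate {u} {w} ¬Su ¬Sw e rewrite e | dec-false (S? u) ¬Su | dec-false (S? w) ¬Sw = refl

  isolated : ∀ {u w} → S u → adj isolate u w ≡ false
  isolated {u} {w} Su rewrite dec-true (S? u) Su = ∧-zeroʳ (adj G u w)

  deg-isolate≤ : ∀ u → deg isolate u ≤ deg G u
  deg-isolate≤ u = length-filter-mono (λ w → adj isolate u w ≟ᵇ true) (λ w → adj G u w ≟ᵇ true)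
    adj-isolate⇒adj (allFin (n G))

  isEdgeOf-isolate⇒ : ∀ A p → isEdgeOf isolate A p ≡ true → isEdgeOf G A p ≡ true
  isEdgeOf-isolate⇒ A (u , w) =
    ∧-monoʳ-true {A u} (∧-monoʳ-true {A w} (∧-monoˡ-true adj-isolate⇒adj))

  edgesIn-isolate≤ : ∀ A → edgesIn isolate A ≤ edgesIn G A
  edgesIn-isolate≤ A = length-filter-mono (λ p → isEdgeOf isolate A p ≟ᵇ true)
    (λ p → isEdgeOf G A p ≟ᵇ true) (isEdgeOf-isolate⇒ A _) (vertexPairs G)

  numEdges-isolate<-at : ∀ {p q} → toℕ p < toℕ q → adj G p q ≡ true → adj isolate p q ≡ false →
                         numEdges isolate < numEdges G
  numEdges-isolate<-at {p} {q} p<q e cut = length-filter-mono-<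
    (λ pair → isEdgeOf isolate (λ _ → true) pair ≟ᵇ true)
    (λ pair → isEdgeOf G (λ _ → true) pair ≟ᵇ true) (isEdgeOf-isolate⇒ (λ _ → true) _)
    (∈-vertexPairs G p q) edge-of-G (λ edge-of-isolate → case trans (sym deleted) edge-of-isolate of λ ())
    where
    edge-of-G : isEdgeOf G (λ _ → true) (p , q) ≡ true
    edge-of-G rewrite e | isYes≗does (toℕ p <? toℕ q) | dec-true (toℕ p <? toℕ q) p<q = refl
    deleted : isEdgeOf isolate (λ _ → true) (p , q) ≡ false
    deleted rewrite cut = refl

  numEdges-isolate< : ∀ {u w} → S u → adj G u w ≡ true → numEdges isolate < numEdges G
  numEdges-isolate< {u} {w} Su e with <-cmp u w
  ... | tri< u<w _ _ = numEdges-isolate<-at u<w e (isolated Su)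
  ... | tri≈ _ u≡w _ = contradiction u≡w (adj⇒≢ G e)
  ... | tri> _ _ w<u = numEdges-isolate<-at w<u (adj-sym G e) (trans (Graph.sym isolate w u) (isolated Su))

  mad-isolate : MadLe18/7 G → MadLe18/7 isolate
  mad-isolate mad A = ≤-trans (*-monoʳ-≤ 7 (edgesIn-isolate≤ A)) (mad A)

  maxDeg-isolate : ∀ {d} → MaxDegLe G d → MaxDegLe isolate d
  maxDeg-isolate Δ≤d u = ≤-trans (deg-isolate≤ u) (Δ≤d u)

module TwoPathReduction
  (G : Graph) (mc : MinimalCounterexample G) {v a b x : Vertex G}
  (v-deg : deg G v ≤ 4)
  (va : adj G v a ≡ true) (a-deg : deg G a ≡ 2) (ab : adj G a b ≡ true) (b≢v : b ≢ v)
  (b-deg : deg G b ≡ 2) (bx : adj G b x ≡ true) (x≢a : x ≢ a)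
  (other : Vertex G → Vertex G)
  (other-spec : ∀ {u} → adj G v u ≡ true × u ≢ a →
                deg G u ≡ 2 × adj G u (other u) ≡ true × other u ≢ v)
  where

  open MinimalCounterexample mc

  adj-a : ∀ {w} → adj G a w ≡ true → w ≡ v ⊎ w ≡ b
  adj-a = deg≡2⇒adj⇒≡⊎≡ G a-deg (adj-sym G va) ab (b≢v ∘ sym)

  adj-b : ∀ {w} → adj G b w ≡ true → w ≡ a ⊎ w ≡ x
  adj-b = deg≡2⇒adj⇒≡⊎≡ G b-deg (adj-sym G ab) bx (x≢a ∘ sym)

  adj-other : ∀ {u w} → adj G v u ≡ true → u ≢ a → adj G u w ≡ true → w ≡ v ⊎ w ≡ other u
  adj-other vu u≢a uw with u-deg , u-o , o≢v ← other-spec (vu , u≢a) =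
    deg≡2⇒adj⇒≡⊎≡ G u-deg (adj-sym G vu) u-o (o≢v ∘ sym) uw

  Nᵥ : List (Vertex G)
  Nᵥ = neighboursExcept G v a

  |Nᵥ|≤3 : length Nᵥ ≤ 3
  |Nᵥ|≤3 = ≤-pred (≤-trans (length-neighboursExcept< G va) v-deg)

  InAB : Pred (Vertex G) 0ℓ
  InAB u = u ≡ a ⊎ u ≡ b

  InAB? : Decidable InAB
  InAB? u = (u ≟ a) ⊎-dec (u ≟ b)

  H : Graph
  H = isolate G InAB?

  H-colouring : TwoDistColorable H 8
  H-colouring = minimal H (mad-isolate G InAB? mad) (maxDeg-isolate G InAB? (proj₁ maxDeg))
                          (+-monoʳ-< (n G) (numEdges-isolate< G InAB? (inj₁ refl) ab))

  Rest : Pred (Vertex G) 0ℓ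
  Rest u = u ≢ a × u ≢ b × u ≢ v

  Rest⇒¬InAB : ∀ {u} → Rest u → ¬ InAB u
  Rest⇒¬InAB (u≢a , _) (inj₁ u≡a) = u≢a u≡a
  Rest⇒¬InAB (_ , u≢b , _) (inj₂ u≡b) = u≢b u≡b

  -- A path through a (resp. b) joins two of v, b (resp. a, x).
  middle-¬InAB : ∀ {u w m} → Rest u → Rest w → u ≢ w →
                 adj G u m ≡ true → adj G m w ≡ true → ¬ InAB m
  middle-¬InAB (_ , u≢b , u≢v) _ _ um _ (inj₁ refl) with adj-a (adj-sym G um)
  ... | inj₁ u≡v = u≢v u≡v
  ... | inj₂ u≡b = u≢b u≡b
  middle-¬InAB (u≢a , _) (w≢a , _) u≢w um mw (inj₂ refl) with adj-b (adj-sym G um) | adj-b mw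
  ... | inj₁ u≡a | _ = u≢a u≡a
  ... | _ | inj₁ w≡a = w≢a w≡a
  ... | inj₂ u≡x | inj₂ w≡x = u≢w (trans u≡x (sym w≡x))

  proper-Rest : ProperOn G (proj₁ H-colouring) Rest
  proper-Rest {u} {w} Ru Rw u≢w d = proj₂ H-colouring u w u≢w (Dist≤2-in-H d)
    where
    Dist≤2-in-H : Dist≤2 G u w → Dist≤2 H u w
    Dist≤2-in-H (inj₁ e) = inj₁ (adj⇒adj-isolate G InAB? (Rest⇒¬InAB Ru) (Rest⇒¬InAB Rw) e)
    Dist≤2-in-H (inj₂ (m , um , mw)) =
      let ¬InAB-m = middle-¬InAB Ru Rw u≢w um mw
      in inj₂ (m , adj⇒adj-isolate G InAB? (Rest⇒¬InAB Ru) ¬InAB-m um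
                 , adj⇒adj-isolate G InAB? ¬InAB-m (Rest⇒¬InAB Rw) mw)

  covers-b : ∀ {w} → Rest w → w ≢ b → Dist≤2 G b w → w ∈ x ∷ neighboursExcept G x b
  covers-b (w≢a , _) _ (inj₁ bw) with adj-b bw
  ... | inj₁ w≡a = contradiction w≡a w≢a
  ... | inj₂ w≡x = here w≡x
  covers-b (_ , _ , w≢v) w≢b (inj₂ (m , bm , mw)) with adj-b bm
  ... | inj₂ refl = there (∈-neighboursExcept G mw w≢b)
  ... | inj₁ refl with adj-a mw
  ...   | inj₁ w≡v = contradiction w≡v w≢v
  ...   | inj₂ w≡b = contradiction w≡b w≢b

  Rest∪b : Pred (Vertex G) 0ℓ
  Rest∪b u = u ≡ b ⊎ Rest u

  Rest∪b⇒≢a : ∀ {u} → Rest∪b u → u ≢ a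
  Rest∪b⇒≢a (inj₁ refl) b≡a = contradiction (sym b≡a) (adj⇒≢ G ab)
  Rest∪b⇒≢a (inj₂ (u≢a , _)) = u≢a

  covers-v : ∀ {w} → Rest∪b w → w ≢ v → Dist≤2 G v w → w ∈ b ∷ Nᵥ ++ map other Nᵥ
  covers-v Cw _ (inj₁ vw) = there (∈-++⁺ˡ (∈-neighboursExcept G vw (Rest∪b⇒≢a Cw)))
  covers-v Cw w≢v (inj₂ (m , vm , mw)) with m ≟ a
  ... | yes refl with adj-a mw
  ...   | inj₁ w≡v = contradiction w≡v w≢v
  ...   | inj₂ w≡b = here w≡b
  covers-v Cw w≢v (inj₂ (m , vm , mw)) | no m≢a with adj-other vm m≢a mw
  ...   | inj₁ w≡v = contradiction w≡v w≢v
  ...   | inj₂ refl = there (∈-++⁺ʳ Nᵥ (∈-map⁺ other (∈-neighboursExcept G vm m≢a)))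

  covers-a : ∀ {w} → w ≢ a → Dist≤2 G a w → w ∈ v ∷ b ∷ x ∷ Nᵥ
  covers-a _ (inj₁ aw) with adj-a aw
  ... | inj₁ w≡v = here w≡v
  ... | inj₂ w≡b = there (here w≡b)
  covers-a w≢a (inj₂ (m , am , mw)) with adj-a am
  ... | inj₁ refl = there (there (there (∈-neighboursExcept G mw w≢a)))
  ... | inj₂ refl with adj-b mw
  ...   | inj₁ w≡a = contradiction w≡a w≢a
  ...   | inj₂ w≡x = there (there (here w≡x))

  |D-b|<8 : length (x ∷ neighboursExcept G x b) < 8
  |D-b|<8 = s≤s (≤-trans (length-neighboursExcept< G (adj-sym G bx)) (proj₁ maxDeg x))

  |D-v|<8 : length (b ∷ Nᵥ ++ map other Nᵥ) < 8
  |D-v|<8 rewrite length-++ Nᵥ {map other Nᵥ} | length-map other Nᵥ =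
    s≤s (s≤s (+-mono-≤ |Nᵥ|≤3 |Nᵥ|≤3))

  |D-a|<8 : length (v ∷ b ∷ x ∷ Nᵥ) < 8
  |D-a|<8 = s≤s (s≤s (s≤s (s≤s (m≤n⇒m≤1+n |Nᵥ|≤3))))

  everyone-coloured : ∀ u → u ≡ a ⊎ u ≡ v ⊎ u ≡ b ⊎ Rest u
  everyone-coloured u with u ≟ a | u ≟ v | u ≟ b
  ... | yes u≡a | _ | _ = inj₁ u≡a
  ... | no _ | yes u≡v | _ = inj₂ (inj₁ u≡v)
  ... | no _ | no _ | yes u≡b = inj₂ (inj₂ (inj₁ u≡b))
  ... | no u≢a | no u≢v | no u≢b = inj₂ (inj₂ (inj₂ (u≢a , u≢b , u≢v)))

  G-colouring : TwoDistColorable G 8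
  G-colouring =
    let c₁ , proper₁ = ProperOn-extend G _ proper-Rest b _ |D-b|<8 covers-b
        c₂ , proper₂ = ProperOn-extend G c₁ proper₁ v _ |D-v|<8 covers-v
        c₃ , proper₃ = ProperOn-extend G c₂ proper₂ a _ |D-a|<8 (λ _ → covers-a)
    in c₃ , λ u w u≢w d → proper₃ (everyone-coloured u) (everyone-coloured w) u≢w d

lemma11 : (G : Graph) → MinimalCounterexample G → (v : Fin (n G)) →
          3 ≤ deg G v → deg G v ≤ 4 → ¬ Is2-1⁺Vertex G v
lemma11 G mc v _ v-deg (a , (va , step a-deg ab b≢v (step b-deg bx x≢a _)) , paths-1⁺)
  with other , other-spec ← 1⁺-paths⇒second-neighbours G paths-1⁺ =
  MinimalCounterexample.noCol mc
    (TwoPathReduction.G-colouring G mc v-deg va a-deg ab b≢v b-deg bx x≢a other other-spec)
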